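{- Let $G$ be a fan graph of order $n\geq 5$. Then $gp(G)=\left\lfloor\frac{2n}{3}\right\rfloor$.
   Context: All graphs are finite, simple, undirected and connected. A set $R\subseteq V(G)$ is a general position set of $G$ if no three distinct vertices of $R$ are such that one of them lies on a shortest path (geodesic) in $G$ between the other two; $gp(G)$ is the maximum size of a general position set. A fan of order $n$ is the graph $F_{n-1}=\{v\}\oplus P_{n-1}$, the join of a single vertex $v$ with a path $P_{n-1}$ on $n-1$ vertices (equivalently, a connected graph of order at least 3 with exactly one vertex of degree $n-1$, exactly two vertices of degree $2$, and all other vertices of degree $3$). -}

module Defs where

open import Data.Nat using (ℕ; zero; suc; _+_; _<_)
open import Data.Fin using (Fin; toℕ) renaming (zero to fz; suc to fs)
open import Data.Fin.Subset using (Subset; _∈_)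
open import Data.Unit using (⊤)
open import Data.Empty using (⊥)
open import Data.Sum using (_⊎_)
open import Data.Product using (∃; ∃-syntax; _×_)
open import Relation.Binary.PropositionalEquality using (_≡_; _≢_)
open import Relation.Nullary using (¬_)

Graph : ℕ → Set₁
Graph n = Fin n → Fin n → Set

module _ {n : ℕ} (G : Graph n) where

  data Walk : Fin n → Fin n → ℕ → Set where
    here : ∀ {u} → Walk u u 0
    step : ∀ {u w v k} → G u w → Walk w v k → Walk u v (suc k)

  IsDist : Fin n → Fin n → ℕ → Set
  IsDist u v d = Walk u v d × (∀ k → k < d → ¬ Walk u v k)

  OnGeodesic : Fin n → Fin n → Fin n → Set
  OnGeodesic w u v = ∃[ a ] ∃[ b ] (Walk u w a × Walk w v b × IsDist u v (a + b))

  IsGPSet : Subset n → Set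
  IsGPSet R = ∀ x y z → x ∈ R → y ∈ R → z ∈ R →
              x ≢ y → y ≢ z → x ≢ z → ¬ OnGeodesic y x z

-- The fan F_{m} = {v} ⊕ P_m of order m+1 on vertex set Fin (suc m):
-- vertex fz is the hub v, vertices fs i (i = 0..m-1) form the path P_m
-- in the order of toℕ i.
Fan : (m : ℕ) → Graph (suc m)
Fan m fz     fz     = ⊥
Fan m fz     (fs _) = ⊤
Fan m (fs _) fz     = ⊤
Fan m (fs i) (fs j) = (suc (toℕ i) ≡ toℕ j) ⊎ (suc (toℕ j) ≡ toℕ i)

-- The fan has diameter 2: any two non-adjacent path vertices are joined
-- through the hub.  Hence a general position set containing the hub meets the
-- path in at most two (adjacent) vertices, and one avoiding the hub contains no
-- three consecutive path vertices, which bounds it by 2n/3.  Conversely, as all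
-- geodesics have length at most 2, a hub-free set without three consecutive
-- path vertices is in general position; taking two out of every three path
-- vertices attains ⌊2n/3⌋.
module Submission where

open import Defs
open import Data.Nat using (ℕ; suc; _*_; _≤_; _/_)
open import Data.Fin.Subset using (Subset; ∣_∣)
open import Data.Product using (_×_; ∃-syntax)
open import Relation.Binary.PropositionalEquality using (_≡_)

open import Data.Nat using (zero; _+_; _<_; z≤n; s≤s; NonZero)
open import Data.Nat.Properties
open import Data.Nat.DivMod using (m*n/n≡m; /-monoˡ-≤; +-distrib-/-∣ˡ)
open import Data.Nat.Divisibility using (divides-refl)
open import Data.Fin using (Fin; toℕ) renaming (zero to fz; suc to fs)
import Data.Fin.Properties as Fin
open import Data.Fin.Subset using (_∈_; inside; outside)
open import Data.Fin.Subset.Properties using (Empty-unique; ∣⊥∣≡0)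
open import Data.Vec using ([]; _∷_; here; there; tabulate)
open import Data.Vec.Properties using ([]=⇒lookup; lookup∘tabulate)
open import Data.Bool using (Bool; true; false)
open import Data.Empty using (⊥; ⊥-elim)
open import Data.Unit using (tt)
open import Data.Sum using (_⊎_; inj₁; inj₂)
open import Data.Product using (_,_)
open import Function using (_∘_)
open import Relation.Binary.PropositionalEquality using (_≢_; refl; sym; trans; cong; subst; module ≡-Reasoning)
open import Relation.Nullary using (¬_)

module _ {n : ℕ} (G : Graph n) where

  commonNeighbour-onGeodesic : ∀ {u w v} → G u w → G w v → u ≢ v → ¬ G u v →
                               OnGeodesic G w u v
  commonNeighbour-onGeodesic uw wv u≢v ¬uv =
    1 , 1 , step uw here , step wv here , step uw (step wv here) , shorter
    where
    shorter : ∀ k → k < 2 → ¬ Walk G _ _ k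
    shorter zero          _ here           = u≢v refl
    shorter (suc zero)    _ (step uv here) = ¬uv uv
    shorter (suc (suc k)) (s≤s (s≤s ()))

  onGeodesic⇒adjacent : ∀ {u w v} → Walk G u v 2 → u ≢ w → w ≢ v →
                        OnGeodesic G w u v → G u w × G w v
  onGeodesic⇒adjacent _ u≢w _ (_ , _ , here , _) = ⊥-elim (u≢w refl)
  onGeodesic⇒adjacent _ _ w≢v (_ , _ , _ , here , _) = ⊥-elim (w≢v refl)
  onGeodesic⇒adjacent _ _ _ (_ , _ , step uw here , step wv here , _) = uw , wv
  onGeodesic⇒adjacent walk₂ _ _ (_ , _ , step _ here , step _ (step _ _) , _ , shortest) =
    ⊥-elim (shortest 2 (s≤s (s≤s (s≤s z≤n))) walk₂)
  onGeodesic⇒adjacent walk₂ _ _ (a , b , step _ (step _ _) , step _ _ , _ , shortest) =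
    ⊥-elim (shortest 2 (+-mono-≤ {2} {a} {1} {b} (s≤s (s≤s z≤n)) (s≤s z≤n)) walk₂)

-- Fan m (fs i) (fs j) unfolds to Adjacentℕ (toℕ i) (toℕ j).
Adjacentℕ : ℕ → ℕ → Set
Adjacentℕ a b = suc a ≡ b ⊎ suc b ≡ a

apart⇒≢ : ∀ {a b} → 2 + a ≤ b → a ≢ b
apart⇒≢ 2+a≤a refl = <-irrefl refl (<-trans (n<1+n _) 2+a≤a)

apart⇒¬adjacent : ∀ {a b} → 2 + a ≤ b → ¬ Adjacentℕ a b
apart⇒¬adjacent 2+a≤b (inj₁ refl) = <-irrefl refl 2+a≤b
apart⇒¬adjacent 2+a≤b (inj₂ refl) = <-irrefl refl (<-trans (n<1+n _) (<-trans (n<1+n _) 2+a≤b))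

adjacent-adjacent⇒consecutive : ∀ {a b c} → Adjacentℕ a b → Adjacentℕ b c → a ≢ c →
                                (suc a ≡ b × suc b ≡ c) ⊎ (suc c ≡ b × suc b ≡ a)
adjacent-adjacent⇒consecutive (inj₁ ab)   (inj₁ bc)   _   = inj₁ (ab , bc)
adjacent-adjacent⇒consecutive (inj₁ refl) (inj₂ refl) a≢c = ⊥-elim (a≢c refl)
adjacent-adjacent⇒consecutive (inj₂ refl) (inj₁ refl) a≢c = ⊥-elim (a≢c refl)
adjacent-adjacent⇒consecutive (inj₂ ba)   (inj₂ cb)   _   = inj₂ (cb , ba)

fs-≢ : ∀ {m} {i j : Fin m} → toℕ i ≢ toℕ j → fs i ≢ fs j
fs-≢ i≢j = i≢j ∘ cong toℕ ∘ Fin.suc-injective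

throughHub : ∀ {m} {i j : Fin m} → Walk (Fan m) (fs i) (fs j) 2
throughHub = step {w = fz} tt (step tt here)

Spread≤1 : ∀ {n} → Subset n → Set
Spread≤1 p = ∀ i j → i ∈ p → j ∈ p → ¬ 2 + toℕ i ≤ toℕ j

NoThreeConsecutive : ∀ {n} → Subset n → Set
NoThreeConsecutive p = ∀ i j k → i ∈ p → j ∈ p → k ∈ p →
                       suc (toℕ i) ≡ toℕ j → suc (toℕ j) ≡ toℕ k → ⊥

gp⇒spread≤1 : ∀ {m} {p : Subset m} → IsGPSet (Fan m) (inside ∷ p) → Spread≤1 p
gp⇒spread≤1 {m} gp i j i∈p j∈p apart =
  gp (fs i) fz (fs j) (there i∈p) here (there j∈p) (λ ()) (λ ()) i≢j
     (commonNeighbour-onGeodesic (Fan m) tt tt i≢j (apart⇒¬adjacent apart))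
  where
  i≢j : fs i ≢ fs j
  i≢j = fs-≢ (apart⇒≢ apart)

gp⇒noThreeConsecutive : ∀ {m} {x} {p : Subset m} → IsGPSet (Fan m) (x ∷ p) →
                        NoThreeConsecutive p
gp⇒noThreeConsecutive {m} gp i j k i∈p j∈p k∈p ij jk =
  gp (fs i) (fs j) (fs k) (there i∈p) (there j∈p) (there k∈p)
     (fs-≢ (1+n≢n ∘ trans ij ∘ sym)) (fs-≢ (1+n≢n ∘ trans jk ∘ sym)) i≢k
     (commonNeighbour-onGeodesic (Fan m) (inj₁ ij) (inj₁ jk) i≢k (apart⇒¬adjacent apart))
  where
  apart : 2 + toℕ i ≤ toℕ k
  apart = ≤-reflexive (trans (cong suc ij) jk)
  i≢k : fs i ≢ fs k
  i≢k = fs-≢ (apart⇒≢ apart)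

noThreeConsecutive⇒gp : ∀ {m} {p : Subset m} → NoThreeConsecutive p →
                        IsGPSet (Fan m) (outside ∷ p)
noThreeConsecutive⇒gp {m} ntc (fs i) (fs j) (fs k) (there i∈p) (there j∈p) (there k∈p) i≢j j≢k i≢k geo
  with onGeodesic⇒adjacent (Fan m) throughHub i≢j j≢k geo
... | ij , jk with adjacent-adjacent⇒consecutive ij jk (i≢k ∘ cong fs ∘ Fin.toℕ-injective)
...   | inj₁ (ij′ , jk′) = ntc i j k i∈p j∈p k∈p ij′ jk′
...   | inj₂ (kj′ , ji′) = ntc k j i k∈p j∈p i∈p kj′ ji′

spread≤1⇒∣p∣≤2 : ∀ {n} (p : Subset n) → Spread≤1 p → ∣ p ∣ ≤ 2
spread≤1⇒∣p∣≤2 []            _ = z≤n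
spread≤1⇒∣p∣≤2 (outside ∷ p) s =
  spread≤1⇒∣p∣≤2 p (λ i j i∈p j∈p → s (fs i) (fs j) (there i∈p) (there j∈p) ∘ s≤s)
spread≤1⇒∣p∣≤2 (inside ∷ []) _ = s≤s z≤n
spread≤1⇒∣p∣≤2 {suc (suc n)} (inside ∷ x ∷ p) s = s≤s (∣x∷∅∣≤1 x)
  where
  ∣p∣≡0 : ∣ p ∣ ≡ 0
  ∣p∣≡0 = trans (cong ∣_∣ (Empty-unique λ (j , j∈p) →
            s fz (fs (fs j)) here (there (there j∈p)) (s≤s (s≤s z≤n)))) (∣⊥∣≡0 n)
  ∣x∷∅∣≤1 : ∀ x → ∣ x ∷ p ∣ ≤ 1
  ∣x∷∅∣≤1 outside = ≤-trans (≤-reflexive ∣p∣≡0) z≤n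
  ∣x∷∅∣≤1 inside  = s≤s (≤-reflexive ∣p∣≡0)

noThreeConsecutive-∷⁻ : ∀ {n} {x} {p : Subset n} → NoThreeConsecutive (x ∷ p) →
                        NoThreeConsecutive p
noThreeConsecutive-∷⁻ ntc i j k i∈p j∈p k∈p ij jk =
  ntc (fs i) (fs j) (fs k) (there i∈p) (there j∈p) (there k∈p) (cong suc ij) (cong suc jk)

3*[a+x]≤2*[b+y] : ∀ a b x y → 3 * a ≤ 2 * b → 3 * x ≤ 2 * y → 3 * (a + x) ≤ 2 * (b + y)
3*[a+x]≤2*[b+y] a b x y ab xy = begin
  3 * (a + x)     ≡⟨ *-distribˡ-+ 3 a x ⟩
  3 * a + 3 * x   ≤⟨ +-mono-≤ ab xy ⟩
  2 * b + 2 * y   ≡⟨ *-distribˡ-+ 2 b y ⟨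
  2 * (b + y)     ∎
  where open ≤-Reasoning

3*∣p∣≤2*[1+n] : ∀ {n} (p : Subset n) → NoThreeConsecutive p → 3 * ∣ p ∣ ≤ 2 * suc n
3*∣p∣≤2*[1+n] [] _ = z≤n
3*∣p∣≤2*[1+n] {suc n} (outside ∷ p) ntc =
  ≤-trans (3*∣p∣≤2*[1+n] p (noThreeConsecutive-∷⁻ ntc)) (*-monoʳ-≤ 2 (n≤1+n (suc n)))
3*∣p∣≤2*[1+n] (inside ∷ []) _ = n≤1+n 3
3*∣p∣≤2*[1+n] (inside ∷ inside ∷ []) _ = ≤-refl
3*∣p∣≤2*[1+n] {suc (suc n)} (inside ∷ outside ∷ p) ntc =
  3*[a+x]≤2*[b+y] 1 2 ∣ p ∣ (suc n) (n≤1+n 3)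
    (3*∣p∣≤2*[1+n] p (noThreeConsecutive-∷⁻ (noThreeConsecutive-∷⁻ ntc)))
3*∣p∣≤2*[1+n] {suc (suc (suc n))} (inside ∷ inside ∷ outside ∷ p) ntc =
  3*[a+x]≤2*[b+y] 2 3 ∣ p ∣ (suc n) ≤-refl
    (3*∣p∣≤2*[1+n] p (noThreeConsecutive-∷⁻ (noThreeConsecutive-∷⁻ (noThreeConsecutive-∷⁻ ntc))))
3*∣p∣≤2*[1+n] (inside ∷ inside ∷ inside ∷ p) ntc =
  ⊥-elim (ntc fz (fs fz) (fs (fs fz)) here (there here) (there (there here)) refl refl)

m*n≤o⇒n≤o/m : ∀ m {n o} .{{_ : NonZero m}} → m * n ≤ o → n ≤ o / m
m*n≤o⇒n≤o/m m {n} {o} m*n≤o = begin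
  n          ≡⟨ m*n/n≡m n m ⟨
  n * m / m  ≤⟨ /-monoˡ-≤ m (subst (_≤ o) (*-comm m n) m*n≤o) ⟩
  o / m      ∎
  where open ≤-Reasoning

twoOfThree : ℕ → Bool
twoOfThree 0 = true
twoOfThree 1 = true
twoOfThree 2 = false
twoOfThree (suc (suc (suc n))) = twoOfThree n

twoOfThreeSet : ∀ n → Subset n
twoOfThreeSet n = tabulate (twoOfThree ∘ toℕ)

twoOfThreeSet-noThreeConsecutive : ∀ n → NoThreeConsecutive (twoOfThreeSet n)
twoOfThreeSet-noThreeConsecutive n i j k i∈p j∈p k∈p ij jk =
  noRun (toℕ i) (member i∈p)
    (trans (cong twoOfThree ij) (member j∈p))
    (trans (cong twoOfThree (trans (cong suc ij) jk)) (member k∈p))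
  where
  member : ∀ {i} → i ∈ twoOfThreeSet n → twoOfThree (toℕ i) ≡ true
  member {i} i∈p = trans (sym (lookup∘tabulate (twoOfThree ∘ toℕ) i)) ([]=⇒lookup i∈p)
  noRun : ∀ a → twoOfThree a ≡ true → twoOfThree (1 + a) ≡ true → twoOfThree (2 + a) ≡ true → ⊥
  noRun 0 _ _ ()
  noRun 1 _ () _
  noRun 2 () _ _
  noRun (suc (suc (suc a))) = noRun a

∣twoOfThreeSet∣ : ∀ n → ∣ twoOfThreeSet n ∣ ≡ 2 * suc n / 3
∣twoOfThreeSet∣ 0 = refl
∣twoOfThreeSet∣ 1 = refl
∣twoOfThreeSet∣ 2 = refl
-- The first step is definitional, since twoOfThree has period 3.
∣twoOfThreeSet∣ (suc (suc (suc n))) = begin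
  2 + ∣ twoOfThreeSet n ∣        ≡⟨ cong (2 +_) (∣twoOfThreeSet∣ n) ⟩
  2 * 3 / 3 + 2 * suc n / 3      ≡⟨ +-distrib-/-∣ˡ (2 * suc n) {d = 3} (divides-refl 2) ⟨
  (2 * 3 + 2 * suc n) / 3        ≡⟨ cong (_/ 3) (*-distribˡ-+ 2 3 (suc n)) ⟨
  2 * (3 + suc n) / 3            ∎
  where open ≡-Reasoning

mainTheorem6 : (m : ℕ) → 5 ≤ suc m →
    (∃[ R ] (IsGPSet (Fan m) R × ∣ R ∣ ≡ (2 * suc m) / 3))
    × (∀ (R : Subset (suc m)) → IsGPSet (Fan m) R → ∣ R ∣ ≤ (2 * suc m) / 3)
mainTheorem6 m 5≤1+m =
  (outside ∷ twoOfThreeSet m ,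
   noThreeConsecutive⇒gp (twoOfThreeSet-noThreeConsecutive m) ,
   ∣twoOfThreeSet∣ m) ,
  upper
  where
  upper : ∀ R → IsGPSet (Fan m) R → ∣ R ∣ ≤ 2 * suc m / 3
  upper (outside ∷ p) gp = m*n≤o⇒n≤o/m 3 (3*∣p∣≤2*[1+n] p (gp⇒noThreeConsecutive gp))
  upper (inside ∷ p) gp = m*n≤o⇒n≤o/m 3 (begin
    3 * suc ∣ p ∣  ≤⟨ *-monoʳ-≤ 3 (s≤s (spread≤1⇒∣p∣≤2 p (gp⇒spread≤1 gp))) ⟩
    3 * 3          <⟨ *-monoʳ-≤ 2 5≤1+m ⟩
    2 * suc m      ∎)
    where open ≤-Reasoning
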